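{- Let $n$ be an odd multiple of $3$. Then it is possible to place $n-2$ queens on $\mathbb{Z}_n^2$ with no two in conflict.
   Context: Queens on the toroidal board $\mathbb{Z}_n^2$ occupy distinct fields; two queens at $(x,y)$ and $(x',y')$ are in conflict iff $x=x'$, or $y=y'$, or $x+y=x'+y'$, or $x-y=x'-y'$ in $\mathbb{Z}_n$. -}

module Defs where

open import Data.Nat using (ℕ; suc; _+_; _*_; _∸_; NonZero)
open import Data.Nat.DivMod using (_%_)
open import Data.Fin using (Fin; toℕ)
open import Data.Product using (_×_; _,_)
open import Data.Sum using (_⊎_)
open import Relation.Binary.PropositionalEquality using (_≡_)
open import Relation.Nullary using (¬_)

Field : ℕ → Set
Field n = Fin n × Fin n

sumMod : (n : ℕ) → .{{_ : NonZero n}} → Field n → ℕ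
sumMod n (x , y) = (toℕ x + toℕ y) % n

diffMod : (n : ℕ) → .{{_ : NonZero n}} → Field n → ℕ
diffMod n (x , y) = (toℕ x + (n ∸ toℕ y)) % n

Conflict : (n : ℕ) → .{{_ : NonZero n}} → Field n → Field n → Set
Conflict n p@(x , y) q@(x' , y') =
  (x ≡ x') ⊎ (y ≡ y') ⊎ (sumMod n p ≡ sumMod n q) ⊎ (diffMod n p ≡ diffMod n q)

NonAttacking : (n : ℕ) → .{{_ : NonZero n}} → (m : ℕ) → (Fin m → Field n) → Set
NonAttacking n m Q =
  (∀ i j → Q i ≡ Q j → i ≡ j) × (∀ i j → ¬ (i ≡ j) → ¬ Conflict n (Q i) (Q j))

-- Put K = k + 1, so that n = 6K + 3, and index the n − 2 queens by i ≤ 6K. Queen i stands on (x, 2x + c), where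
--   x = i     and c = 0   for i ≤ 2K,
--   x = i     and c = 1   for 2K < i ≤ 3K,
--   x = i     and c = 2   for 3K < i ≤ 5K + 1,
--   x = i + 1 and c = 1   for 5K + 1 < i ≤ 6K,
-- so its four lines are labelled x, 2x + c, 3x + c and −(x + c) modulo n. On each range the labels are affine in i,
-- and the ranges are told apart by the residue of the label mod 2 (rows) or mod 3 (sum diagonals) and by thresholds.
-- Hence every label map has an explicit left inverse and is injective.

module Submission where

open import Defs
open import Algebra.Properties.CommutativeSemigroup using (x∙yz≈y∙xz)
open import Data.Bool using (if_then_else_)
open import Data.Empty using (⊥-elim)
open import Data.Fin using (Fin; toℕ; fromℕ<)
open import Data.Fin.Properties using (toℕ-fromℕ<; toℕ-injective; toℕ<n)
open import Data.List using (_∷_; [])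
open import Data.Nat using (ℕ; zero; suc; pred; _+_; _*_; _∸_; _≤_; _<_; _≤?_; _<?_; z≤n; s≤s; z<s; NonZero)
open import Data.Nat.DivMod using (_%_; _/_; [m+kn]%n≡m%n; m<n⇒m%n≡m; m<n⇒m/n≡0; m*n/n≡m; +-distrib-/-∣ʳ)
open import Data.Nat.Divisibility using (divides-refl)
open import Data.Nat.Properties
  using (≤-pred; ≤-trans; <⇒≤; ≰⇒>; <⇒≱; ≤⇒≯; m≤m+n; m+1+n≰m; m+[n∸m]≡n; m+n∸n≡m; +-cancelˡ-≡; +-commutativeSemigroup)
open import Data.Nat.Tactic.RingSolver using (solve)
open import Data.Product using (Σ; ∃; _,_; proj₁; proj₂)
open import Data.Sum using (_⊎_; inj₁; inj₂)
open import Function using (_∘_)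
open import Relation.Nullary using (¬_; Dec; yes; no; does)
open import Relation.Nullary.Decidable using (dec-true; dec-false)
open import Relation.Binary.PropositionalEquality

if-yes : ∀ {a p} {A : Set a} {P : Set p} (P? : Dec P) {x y : A} → P → (if does P? then x else y) ≡ x
if-yes P? p = cong (if_then _ else _) (dec-true P? p)

if-no : ∀ {a p} {A : Set a} {P : Set p} (P? : Dec P) {x y : A} → ¬ P → (if does P? then x else y) ≡ y
if-no P? ¬p = cong (if_then _ else _) (dec-false P? ¬p)

m+z≡n⇒m≤n : ∀ {m n} z → m + z ≡ n → m ≤ n
m+z≡n⇒m≤n {m} z refl = m≤m+n m z

m≤n⇒m≢n+1+o : ∀ {m n} → m ≤ n → ∀ o → m ≢ n + suc o
m≤n⇒m≢n+1+o {n = n} m≤n o refl = m+1+n≰m n m≤n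

m+n≡o⇒o∸n≡m : ∀ {m n o} → m + n ≡ o → o ∸ n ≡ m
m+n≡o⇒o∸n≡m {m} {n} refl = m+n∸n≡m m n

≤-or-> : ∀ m n → (∃ λ w → m + w ≡ n) ⊎ (∃ λ j → suc n + j ≡ m)
≤-or-> m n with m ≤? n
... | yes m≤n = inj₁ (n ∸ m , m+[n∸m]≡n m≤n)
... | no  m≰n = inj₂ (m ∸ suc n , m+[n∸m]≡n (≰⇒> m≰n))

module _ {n : ℕ} .{{_ : NonZero n}} where

  [r+qn]%n≡r : ∀ r q → r < n → (r + q * n) % n ≡ r
  [r+qn]%n≡r r q r<n = trans ([m+kn]%n≡m%n r q n) (m<n⇒m%n≡m r<n)

  [r+qn]/n≡q : ∀ r q → r < n → (r + q * n) / n ≡ q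
  [r+qn]/n≡q r q r<n = begin
    (r + q * n) / n        ≡⟨ +-distrib-/-∣ʳ r (divides-refl q) ⟩
    r / n + q * n / n      ≡⟨ cong₂ _+_ (m<n⇒m/n≡0 r<n) (m*n/n≡m q n) ⟩
    q                      ∎
    where open ≡-Reasoning

  [x+[n∸y]]%n≡d : ∀ {x y d} q → y ≤ n → d < n → x + n ≡ y + (d + q * n) → (x + (n ∸ y)) % n ≡ d
  [x+[n∸y]]%n≡d {x} {y} {d} q y≤n d<n eq = trans (cong (_% n) x+[n∸y]≡d+qn) ([r+qn]%n≡r d q d<n)
    where
    open ≡-Reasoning
    x+[n∸y]≡d+qn : x + (n ∸ y) ≡ d + q * n
    x+[n∸y]≡d+qn = +-cancelˡ-≡ y _ _ (begin
      y + (x + (n ∸ y))   ≡⟨ x∙yz≈y∙xz +-commutativeSemigroup y x (n ∸ y) ⟩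
      x + (y + (n ∸ y))   ≡⟨ cong (x +_) (m+[n∸m]≡n y≤n) ⟩
      x + n               ≡⟨ eq ⟩
      y + (d + q * n)     ∎)

nonAttacking-byLeftInverses : ∀ {n m} .{{_ : NonZero n}} (Q : Fin m → Field n) (col⁻¹ row⁻¹ sum⁻¹ diff⁻¹ : ℕ → ℕ) →
  (∀ i → col⁻¹ (toℕ (proj₁ (Q i))) ≡ toℕ i) →
  (∀ i → row⁻¹ (toℕ (proj₂ (Q i))) ≡ toℕ i) →
  (∀ i → sum⁻¹ (sumMod n (Q i)) ≡ toℕ i) →
  (∀ i → diff⁻¹ (diffMod n (Q i)) ≡ toℕ i) →
  NonAttacking n m Q
nonAttacking-byLeftInverses {n} {m} Q col⁻¹ row⁻¹ sum⁻¹ diff⁻¹ col row sum diff =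
  (λ i j Qi≡Qj → injective col⁻¹ col (cong (toℕ ∘ proj₁) Qi≡Qj)) , noConflict
  where
  injective : ∀ {f : Fin m → ℕ} (g : ℕ → ℕ) → (∀ i → g (f i) ≡ toℕ i) → ∀ {i j} → f i ≡ f j → i ≡ j
  injective g g∘f≗toℕ {i} {j} fi≡fj = toℕ-injective (trans (sym (g∘f≗toℕ i)) (trans (cong g fi≡fj) (g∘f≗toℕ j)))

  noConflict : ∀ i j → ¬ i ≡ j → ¬ Conflict n (Q i) (Q j)
  noConflict i j i≢j (inj₁ same-column)               = i≢j (injective col⁻¹ col (cong toℕ same-column))
  noConflict i j i≢j (inj₂ (inj₁ same-row))           = i≢j (injective row⁻¹ row (cong toℕ same-row))
  noConflict i j i≢j (inj₂ (inj₂ (inj₁ same-sum)))    = i≢j (injective sum⁻¹ sum same-sum)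
  noConflict i j i≢j (inj₂ (inj₂ (inj₂ same-diff)))   = i≢j (injective diff⁻¹ diff same-diff)

single-queen-nonAttacking : ∀ {n} .{{_ : NonZero n}} (p : Field n) → NonAttacking n 1 (λ _ → p)
single-queen-nonAttacking p = (λ { Fin.zero Fin.zero _ → refl }) , (λ { Fin.zero Fin.zero 0≢0 _ → 0≢0 refl })

module Decoding (k : ℕ) where

  col⁻¹ : ℕ → ℕ
  col⁻¹ x = if does (x ≤? 5 * suc k + 1) then x else pred x

  row⁻¹′ : ℕ → ℕ → ℕ
  row⁻¹′ zero    q = if does (q ≤? 2 * suc k) then q else 3 * suc k + q
  row⁻¹′ (suc _) q = if does (q ≤? 2 * suc k) then 3 * suc k + 1 + q else q

  row⁻¹ : ℕ → ℕ
  row⁻¹ y = row⁻¹′ (y % 2) (y / 2)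

  sum⁻¹′ : ℕ → ℕ → ℕ
  sum⁻¹′ zero          q = q
  sum⁻¹′ (suc zero)    q = if does (q <? suc k) then 2 * suc k + 1 + q else 4 * suc k + 1 + q
  sum⁻¹′ (suc (suc _)) q = if does (q <? suc k) then 4 * suc k + 2 + q else 2 * suc k + 1 + q

  sum⁻¹ : ℕ → ℕ
  sum⁻¹ s = sum⁻¹′ (s % 3) (s / 3)

  diff⁻¹ : ℕ → ℕ
  diff⁻¹ zero        = zero
  diff⁻¹ d@(suc _) =
    if does (d ≤? 3 * suc k) then 6 * suc k + 1 ∸ d
    else if does (d ≤? 4 * suc k + 1) then 6 * suc k + 2 ∸ d
    else 6 * suc k + 3 ∸ d

  col⁻¹-≤ : ∀ x {i} → x ≤ 5 * suc k + 1 → x ≡ i → col⁻¹ x ≡ i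
  col⁻¹-≤ x x≤ refl = if-yes (x ≤? _) x≤

  col⁻¹-> : ∀ x {i} → 5 * suc k + 1 < x → x ≡ suc i → col⁻¹ x ≡ i
  col⁻¹-> x >x refl = if-no (x ≤? _) (<⇒≱ >x)

  row⁻¹-digits : ∀ r q → r < 2 → row⁻¹ (r + q * 2) ≡ row⁻¹′ r q
  row⁻¹-digits r q r<2 = cong₂ row⁻¹′ ([r+qn]%n≡r r q r<2) ([r+qn]/n≡q r q r<2)

  row⁻¹-even-≤ : ∀ q {i} → q ≤ 2 * suc k → q ≡ i → row⁻¹ (q * 2) ≡ i
  row⁻¹-even-≤ q q≤ refl = trans (row⁻¹-digits 0 q z<s) (if-yes (q ≤? _) q≤)

  row⁻¹-even-> : ∀ q {i} → 2 * suc k < q → 3 * suc k + q ≡ i → row⁻¹ (q * 2) ≡ i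
  row⁻¹-even-> q >q refl = trans (row⁻¹-digits 0 q z<s) (if-no (q ≤? _) (<⇒≱ >q))

  row⁻¹-odd-≤ : ∀ q {i} → q ≤ 2 * suc k → 3 * suc k + 1 + q ≡ i → row⁻¹ (1 + q * 2) ≡ i
  row⁻¹-odd-≤ q q≤ refl = trans (row⁻¹-digits 1 q (s≤s z<s)) (if-yes (q ≤? _) q≤)

  row⁻¹-odd-> : ∀ q {i} → 2 * suc k < q → q ≡ i → row⁻¹ (1 + q * 2) ≡ i
  row⁻¹-odd-> q >q refl = trans (row⁻¹-digits 1 q (s≤s z<s)) (if-no (q ≤? _) (<⇒≱ >q))

  sum⁻¹-digits : ∀ r q → r < 3 → sum⁻¹ (r + q * 3) ≡ sum⁻¹′ r q
  sum⁻¹-digits r q r<3 = cong₂ sum⁻¹′ ([r+qn]%n≡r r q r<3) ([r+qn]/n≡q r q r<3)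

  sum⁻¹-0 : ∀ q {i} → q ≡ i → sum⁻¹ (q * 3) ≡ i
  sum⁻¹-0 q refl = sum⁻¹-digits 0 q z<s

  sum⁻¹-1-< : ∀ q {i} → q < suc k → 2 * suc k + 1 + q ≡ i → sum⁻¹ (1 + q * 3) ≡ i
  sum⁻¹-1-< q q< refl = trans (sum⁻¹-digits 1 q (s≤s z<s)) (if-yes (q <? _) q<)

  sum⁻¹-1-≥ : ∀ q {i} → suc k ≤ q → 4 * suc k + 1 + q ≡ i → sum⁻¹ (1 + q * 3) ≡ i
  sum⁻¹-1-≥ q ≤q refl = trans (sum⁻¹-digits 1 q (s≤s z<s)) (if-no (q <? _) (≤⇒≯ ≤q))

  sum⁻¹-2-< : ∀ q {i} → q < suc k → 4 * suc k + 2 + q ≡ i → sum⁻¹ (2 + q * 3) ≡ i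
  sum⁻¹-2-< q q< refl = trans (sum⁻¹-digits 2 q (s≤s (s≤s z<s))) (if-yes (q <? _) q<)

  sum⁻¹-2-≥ : ∀ q {i} → suc k ≤ q → 2 * suc k + 1 + q ≡ i → sum⁻¹ (2 + q * 3) ≡ i
  sum⁻¹-2-≥ q ≤q refl = trans (sum⁻¹-digits 2 q (s≤s (s≤s z<s))) (if-no (q <? _) (≤⇒≯ ≤q))

  diff⁻¹-≤3K : ∀ d {i} → 0 < d → d ≤ 3 * suc k → i + d ≡ 6 * suc k + 1 → diff⁻¹ d ≡ i
  diff⁻¹-≤3K (suc d) _ d≤ eq = trans (if-yes (suc d ≤? _) d≤) (m+n≡o⇒o∸n≡m eq)

  diff⁻¹-≤4K+1 : ∀ d {i} → 3 * suc k < d → d ≤ 4 * suc k + 1 → i + d ≡ 6 * suc k + 2 → diff⁻¹ d ≡ i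
  diff⁻¹-≤4K+1 (suc d) >d d≤ eq =
    trans (if-no (suc d ≤? _) (<⇒≱ >d)) (trans (if-yes (suc d ≤? _) d≤) (m+n≡o⇒o∸n≡m eq))

  diff⁻¹->4K+1 : ∀ d {i} → 4 * suc k + 1 < d → i + d ≡ 6 * suc k + 3 → diff⁻¹ d ≡ i
  diff⁻¹->4K+1 (suc d) >d eq =
    trans (if-no (suc d ≤? _) (<⇒≱ (≤-trans (s≤s 3K≤4K+1) >d)))
      (trans (if-no (suc d ≤? _) (<⇒≱ >d)) (m+n≡o⇒o∸n≡m eq))
    where
    3K≤4K+1 : 3 * suc k ≤ 4 * suc k + 1
    3K≤4K+1 = m+z≡n⇒m≤n (suc (suc k)) (solve (k ∷ []))

  -- n is spelled out in the fields, as the ring solver would treat a defined constant as an atom.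
  record Queen (i : ℕ) : Set where
    field
      x y s d : ℕ
      x<n     : x < 3 * (2 * suc k + 1)
      y<n     : y < 3 * (2 * suc k + 1)
      s<n     : s < 3 * (2 * suc k + 1)
      d<n     : d < 3 * (2 * suc k + 1)
      x+y≡s   : ∃ λ q → x + y ≡ s + q * (3 * (2 * suc k + 1))
      x-y≡d   : ∃ λ q → x + 3 * (2 * suc k + 1) ≡ y + (d + q * (3 * (2 * suc k + 1)))
      col     : col⁻¹ x ≡ i
      row     : row⁻¹ y ≡ i
      sum     : sum⁻¹ s ≡ i
      diff    : diff⁻¹ d ≡ i

  n : ℕ
  n = 3 * (2 * suc k + 1)

  module _ {i : ℕ} (q : Queen i) where
    open Queen q

    position : Field n
    position = fromℕ< x<n , fromℕ< y<n

    position-col : col⁻¹ (toℕ (proj₁ position)) ≡ i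
    position-col = trans (cong col⁻¹ (toℕ-fromℕ< x<n)) col

    position-row : row⁻¹ (toℕ (proj₂ position)) ≡ i
    position-row = trans (cong row⁻¹ (toℕ-fromℕ< y<n)) row

    position-sum : sum⁻¹ (sumMod n position) ≡ i
    position-sum = trans (cong sum⁻¹ sumMod≡s) sum
      where
      sumMod≡s : sumMod n position ≡ s
      sumMod≡s = begin
        (toℕ (fromℕ< x<n) + toℕ (fromℕ< y<n)) % n  ≡⟨ cong₂ (λ a b → (a + b) % n) (toℕ-fromℕ< x<n) (toℕ-fromℕ< y<n) ⟩
        (x + y) % n                                 ≡⟨ cong (_% n) (proj₂ x+y≡s) ⟩
        (s + proj₁ x+y≡s * n) % n                   ≡⟨ [r+qn]%n≡r s (proj₁ x+y≡s) s<n ⟩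
        s                                           ∎
        where open ≡-Reasoning

    position-diff : diff⁻¹ (diffMod n position) ≡ i
    position-diff = trans (cong diff⁻¹ diffMod≡d) diff
      where
      diffMod≡d : diffMod n position ≡ d
      diffMod≡d = trans (cong₂ (λ a b → (a + (n ∸ b)) % n) (toℕ-fromℕ< x<n) (toℕ-fromℕ< y<n))
                        ([x+[n∸y]]%n≡d (proj₁ x-y≡d) (<⇒≤ y<n) d<n (proj₂ x-y≡d))

open Decoding using (Queen)

-- Each range of indices is parametrised by t + w = k, which makes its arithmetic polynomial in t and w;
-- every inequality is certified by its difference.
queen-0 : ∀ k → Queen k 0
queen-0 k = record
  { x = 0 ; y = 0 ; s = 0 ; d = 0
  ; x<n = z<s ; y<n = z<s ; s<n = z<s ; d<n = z<s
  ; x+y≡s = 0 , refl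
  ; x-y≡d = 1 , solve (k ∷ [])
  ; col  = col⁻¹-≤ 0 z≤n refl
  ; row  = row⁻¹-even-≤ 0 z≤n refl
  ; sum  = sum⁻¹-0 0 refl
  ; diff = refl
  }
  where open Decoding k

queen-≤K : ∀ t w → Queen (t + w) (suc t)
queen-≤K t w = record
  { x = suc t ; y = suc t * 2 ; s = suc t * 3 ; d = 5 * t + 6 * w + 8
  ; x<n = m+z≡n⇒m≤n (5 * t + 6 * w + 7) (solve (t ∷ w ∷ []))
  ; y<n = m+z≡n⇒m≤n (4 * t + 6 * w + 6) (solve (t ∷ w ∷ []))
  ; s<n = m+z≡n⇒m≤n (3 * t + 6 * w + 5) (solve (t ∷ w ∷ []))
  ; d<n = m+z≡n⇒m≤n t (solve (t ∷ w ∷ []))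
  ; x+y≡s = 0 , solve (t ∷ w ∷ [])
  ; x-y≡d = 0 , solve (t ∷ w ∷ [])
  ; col  = col⁻¹-≤ (suc t) (m+z≡n⇒m≤n (4 * t + 5 * w + 5) (solve (t ∷ w ∷ []))) refl
  ; row  = row⁻¹-even-≤ (suc t) (m+z≡n⇒m≤n (t + 2 * w + 1) (solve (t ∷ w ∷ []))) refl
  ; sum  = sum⁻¹-0 (suc t) refl
  ; diff = diff⁻¹->4K+1 (5 * t + 6 * w + 8) (m+z≡n⇒m≤n (t + 2 * w + 2) (solve (t ∷ w ∷ []))) (solve (t ∷ w ∷ []))
  }
  where open Decoding (t + w)

queen-≤2K : ∀ t w → Queen (t + w) (suc (suc (t + w) + t))
queen-≤2K t w = record
  { x = suc (suc (t + w) + t) ; y = suc (suc (t + w) + t) * 2 ; s = suc (suc (t + w) + t) * 3 ; d = 4 * t + 5 * w + 7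
  ; x<n = m+z≡n⇒m≤n (4 * t + 5 * w + 6) (solve (t ∷ w ∷ []))
  ; y<n = m+z≡n⇒m≤n (2 * t + 4 * w + 4) (solve (t ∷ w ∷ []))
  ; s<n = m+z≡n⇒m≤n (3 * w + 2) (solve (t ∷ w ∷ []))
  ; d<n = m+z≡n⇒m≤n (2 * t + w + 1) (solve (t ∷ w ∷ []))
  ; x+y≡s = 0 , solve (t ∷ w ∷ [])
  ; x-y≡d = 0 , solve (t ∷ w ∷ [])
  ; col  = col⁻¹-≤ (suc (suc (t + w) + t)) (m+z≡n⇒m≤n (3 * t + 4 * w + 4) (solve (t ∷ w ∷ []))) refl
  ; row  = row⁻¹-even-≤ (suc (suc (t + w) + t)) (m+z≡n⇒m≤n w (solve (t ∷ w ∷ []))) refl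
  ; sum  = sum⁻¹-0 (suc (suc (t + w) + t)) refl
  ; diff = diff⁻¹->4K+1 (4 * t + 5 * w + 7) (m+z≡n⇒m≤n (w + 1) (solve (t ∷ w ∷ []))) (solve (t ∷ w ∷ []))
  }
  where open Decoding (t + w)

queen-≤3K : ∀ t w → Queen (t + w) (2 * suc (t + w) + 1 + t)
queen-≤3K t w = record
  { x = 2 * suc (t + w) + 1 + t ; y = 1 + (2 * suc (t + w) + 1 + t) * 2 ; s = 1 + t * 3 ; d = 3 * t + 4 * w + 5
  ; x<n = m+z≡n⇒m≤n (3 * t + 4 * w + 5) (solve (t ∷ w ∷ []))
  ; y<n = m+z≡n⇒m≤n (2 * w + 1) (solve (t ∷ w ∷ []))
  ; s<n = m+z≡n⇒m≤n (3 * t + 6 * w + 7) (solve (t ∷ w ∷ []))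
  ; d<n = m+z≡n⇒m≤n (3 * t + 2 * w + 3) (solve (t ∷ w ∷ []))
  ; x+y≡s = 1 , solve (t ∷ w ∷ [])
  ; x-y≡d = 0 , solve (t ∷ w ∷ [])
  ; col  = col⁻¹-≤ (2 * suc (t + w) + 1 + t) (m+z≡n⇒m≤n (2 * t + 3 * w + 3) (solve (t ∷ w ∷ []))) refl
  ; row  = row⁻¹-odd-> (2 * suc (t + w) + 1 + t) (m+z≡n⇒m≤n t (solve (t ∷ w ∷ []))) refl
  ; sum  = sum⁻¹-1-< t (m+z≡n⇒m≤n w (solve (t ∷ w ∷ []))) refl
  ; diff = diff⁻¹-≤4K+1 (3 * t + 4 * w + 5) (m+z≡n⇒m≤n (w + 1) (solve (t ∷ w ∷ [])))
             (m+z≡n⇒m≤n t (solve (t ∷ w ∷ []))) (solve (t ∷ w ∷ []))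
  }
  where open Decoding (t + w)

queen-≤4K : ∀ t w → Queen (t + w) (3 * suc (t + w) + 1 + t)
queen-≤4K t w = record
  { x = 3 * suc (t + w) + 1 + t ; y = 1 + t * 2 ; s = 2 + (suc (t + w) + t) * 3 ; d = 2 * t + 3 * w + 3
  ; x<n = m+z≡n⇒m≤n (2 * t + 3 * w + 4) (solve (t ∷ w ∷ []))
  ; y<n = m+z≡n⇒m≤n (4 * t + 6 * w + 7) (solve (t ∷ w ∷ []))
  ; s<n = m+z≡n⇒m≤n (3 * w + 3) (solve (t ∷ w ∷ []))
  ; d<n = m+z≡n⇒m≤n (4 * t + 3 * w + 5) (solve (t ∷ w ∷ []))
  ; x+y≡s = 0 , solve (t ∷ w ∷ [])
  ; x-y≡d = 1 , solve (t ∷ w ∷ [])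
  ; col  = col⁻¹-≤ (3 * suc (t + w) + 1 + t) (m+z≡n⇒m≤n (t + 2 * w + 2) (solve (t ∷ w ∷ []))) refl
  ; row  = row⁻¹-odd-≤ t (m+z≡n⇒m≤n (t + 2 * w + 2) (solve (t ∷ w ∷ []))) refl
  ; sum  = sum⁻¹-2-≥ (suc (t + w) + t) (m+z≡n⇒m≤n t (solve (t ∷ w ∷ []))) (solve (t ∷ w ∷ []))
  ; diff = diff⁻¹-≤3K (2 * t + 3 * w + 3) (m+z≡n⇒m≤n (2 * t + 3 * w + 2) (solve (t ∷ w ∷ [])))
             (m+z≡n⇒m≤n t (solve (t ∷ w ∷ []))) (solve (t ∷ w ∷ []))
  }
  where open Decoding (t + w)

queen-4K+1 : ∀ k → Queen k (4 * suc k + 1)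
queen-4K+1 k = record
  { x = 4 * suc k + 1 ; y = 1 + suc k * 2 ; s = 2 + (2 * suc k) * 3 ; d = 2 * suc k
  ; x<n = m+z≡n⇒m≤n (2 * k + 3) (solve (k ∷ []))
  ; y<n = m+z≡n⇒m≤n (4 * k + 5) (solve (k ∷ []))
  ; s<n = m+z≡n⇒m≤n 0 (solve (k ∷ []))
  ; d<n = m+z≡n⇒m≤n (4 * k + 6) (solve (k ∷ []))
  ; x+y≡s = 0 , solve (k ∷ [])
  ; x-y≡d = 1 , solve (k ∷ [])
  ; col  = col⁻¹-≤ (4 * suc k + 1) (m+z≡n⇒m≤n (suc k) (solve (k ∷ []))) refl
  ; row  = row⁻¹-odd-≤ (suc k) (m+z≡n⇒m≤n (suc k) (solve (k ∷ []))) (solve (k ∷ []))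
  ; sum  = sum⁻¹-2-≥ (2 * suc k) (m+z≡n⇒m≤n (suc k) (solve (k ∷ []))) (solve (k ∷ []))
  ; diff = diff⁻¹-≤3K (2 * suc k) (m+z≡n⇒m≤n (2 * k + 1) (solve (k ∷ [])))
             (m+z≡n⇒m≤n (suc k) (solve (k ∷ []))) (solve (k ∷ []))
  }
  where open Decoding k

queen-≤5K+1 : ∀ t w → Queen (t + w) (4 * suc (t + w) + 2 + t)
queen-≤5K+1 t w = record
  { x = 4 * suc (t + w) + 2 + t ; y = 1 + (suc (t + w) + 1 + t) * 2 ; s = 2 + t * 3 ; d = t + 2 * w + 1
  ; x<n = m+z≡n⇒m≤n (t + 2 * w + 2) (solve (t ∷ w ∷ []))
  ; y<n = m+z≡n⇒m≤n (2 * t + 4 * w + 3) (solve (t ∷ w ∷ []))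
  ; s<n = m+z≡n⇒m≤n (3 * t + 6 * w + 6) (solve (t ∷ w ∷ []))
  ; d<n = m+z≡n⇒m≤n (5 * t + 4 * w + 7) (solve (t ∷ w ∷ []))
  ; x+y≡s = 1 , solve (t ∷ w ∷ [])
  ; x-y≡d = 1 , solve (t ∷ w ∷ [])
  ; col  = col⁻¹-≤ (4 * suc (t + w) + 2 + t) (m+z≡n⇒m≤n w (solve (t ∷ w ∷ []))) refl
  ; row  = row⁻¹-odd-≤ (suc (t + w) + 1 + t) (m+z≡n⇒m≤n w (solve (t ∷ w ∷ []))) (solve (t ∷ w ∷ []))
  ; sum  = sum⁻¹-2-< t (m+z≡n⇒m≤n w (solve (t ∷ w ∷ []))) refl
  ; diff = diff⁻¹-≤3K (t + 2 * w + 1) (m+z≡n⇒m≤n (t + 2 * w) (solve (t ∷ w ∷ [])))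
             (m+z≡n⇒m≤n (2 * t + w + 2) (solve (t ∷ w ∷ []))) (solve (t ∷ w ∷ []))
  }
  where open Decoding (t + w)

queen-≤6K : ∀ t w → Queen (suc t + w) (5 * suc (suc t + w) + 2 + t)
queen-≤6K t w = record
  { x = suc (5 * suc (suc t + w) + 2 + t) ; y = (2 * suc (suc t + w) + 2 + t) * 2
  ; s = 1 + (suc (suc t + w) + 1 + t) * 3 ; d = suc w
  ; x<n = m+z≡n⇒m≤n (w + 1) (solve (t ∷ w ∷ []))
  ; y<n = m+z≡n⇒m≤n (2 * w + 2) (solve (t ∷ w ∷ []))
  ; s<n = m+z≡n⇒m≤n (3 * w + 4) (solve (t ∷ w ∷ []))
  ; d<n = m+z≡n⇒m≤n (6 * t + 5 * w + 13) (solve (t ∷ w ∷ []))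
  ; x+y≡s = 1 , solve (t ∷ w ∷ [])
  ; x-y≡d = 1 , solve (t ∷ w ∷ [])
  ; col  = col⁻¹-> (suc (5 * suc (suc t + w) + 2 + t)) (m+z≡n⇒m≤n (t + 1) (solve (t ∷ w ∷ []))) refl
  ; row  = row⁻¹-even-> (2 * suc (suc t + w) + 2 + t) (m+z≡n⇒m≤n (t + 1) (solve (t ∷ w ∷ []))) (solve (t ∷ w ∷ []))
  ; sum  = sum⁻¹-1-≥ (suc (suc t + w) + 1 + t) (m+z≡n⇒m≤n (t + 1) (solve (t ∷ w ∷ []))) (solve (t ∷ w ∷ []))
  ; diff = diff⁻¹-≤3K (suc w) (m+z≡n⇒m≤n w (solve (t ∷ w ∷ [])))
             (m+z≡n⇒m≤n (3 * t + 2 * w + 5) (solve (t ∷ w ∷ []))) (solve (t ∷ w ∷ []))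
  }
  where open Decoding (suc t + w)

reindex : ∀ {k i j} → Queen k i → i ≡ j → Queen k j
reindex q refl = q

queen : ∀ k i → i ≤ 6 * suc k → Queen k i
queen k zero _ = queen-0 k
queen k (suc i) i<6K with ≤-or-> i k
... | inj₁ (w , refl) = queen-≤K i w
... | inj₂ (i₁ , refl) with ≤-or-> i₁ k
...   | inj₁ (w , refl) = queen-≤2K i₁ w
...   | inj₂ (i₂ , refl) with ≤-or-> i₂ k
...     | inj₁ (w , refl) = reindex (queen-≤3K i₂ w) (solve (i₂ ∷ w ∷ []))
...     | inj₂ (i₃ , refl) with ≤-or-> i₃ k
...       | inj₁ (w , refl) = reindex (queen-≤4K i₃ w) (solve (i₃ ∷ w ∷ []))
...       | inj₂ (zero , refl) = reindex (queen-4K+1 k) (solve (k ∷ []))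
...       | inj₂ (suc i₄ , refl) with ≤-or-> i₄ k
...         | inj₁ (w , refl) = reindex (queen-≤5K+1 i₄ w) (solve (i₄ ∷ w ∷ []))
...         | inj₂ (i₅ , refl) with ≤-or-> (suc i₅) k
...           | inj₁ (w , refl) = reindex (queen-≤6K i₅ w) (solve (i₅ ∷ w ∷ []))
...           | inj₂ (i₆ , refl) = ⊥-elim (m≤n⇒m≢n+1+o i<6K i₆ (solve (k ∷ i₆ ∷ [])))

module Placement (k : ℕ) where
  open Decoding k hiding (Queen)

  index≤6K : (i : Fin (n ∸ 2)) → toℕ i ≤ 6 * suc k
  index≤6K i = ≤-pred (subst (toℕ i <_) (cong (_∸ 2) n≡2+[1+6K]) (toℕ<n i))
    where
    n≡2+[1+6K] : 3 * (2 * suc k + 1) ≡ 2 + suc (6 * suc k)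
    n≡2+[1+6K] = solve (k ∷ [])

  queenAt : (i : Fin (n ∸ 2)) → Queen k (toℕ i)
  queenAt i = queen k (toℕ i) (index≤6K i)

  placement : Fin (n ∸ 2) → Field n
  placement i = position (queenAt i)

  placement-nonAttacking : NonAttacking n (n ∸ 2) placement
  placement-nonAttacking = nonAttacking-byLeftInverses placement col⁻¹ row⁻¹ sum⁻¹ diff⁻¹
    (position-col ∘ queenAt) (position-row ∘ queenAt) (position-sum ∘ queenAt) (position-diff ∘ queenAt)

lemma3 : (n k : ℕ) → .{{_ : NonZero n}} → n ≡ 3 * (2 * k + 1) →
    Σ (Fin (n ∸ 2) → Field n) (λ Q → NonAttacking n (n ∸ 2) Q)
lemma3 n zero    refl = (λ _ → Fin.zero , Fin.zero) , single-queen-nonAttacking (Fin.zero , Fin.zero)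
lemma3 n (suc k) refl = placement , placement-nonAttacking
  where open Placement k
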